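{- For every positive integer $n$, let $T_n$ be the triangular board with side $n$ in the triangular grid. Then the minimal number $x(n)$ of maximal fragments needed to cover $T_n$ equals $\lceil n^2/4 \rceil$.
   Context: The triangular grid is the tiling of the plane by congruent unit equilateral triangles (cells); two cells are neighbors if they share an edge. The triangular board with side $n$ is the set of the $n^2$ cells contained in an equilateral triangle of side length $n$ whose sides lie along grid lines. A maximal fragment is a cell together with its three neighbors (a set of 4 cells forming a triangle of side 2). A cover of $T_n$ by maximal fragments is a finite collection of maximal fragments placed in the grid whose union contains $T_n$; the fragments may overlap each other and may contain cells outside $T_n$. $x(n)$ is the minimum size of such a cover. -}

module Defs where

open import Data.Nat using (ℕ; suc; _*_; _+_; _≤_; _<_; _/_)
open import Data.Integer as ℤ using (ℤ; +_; _-_; 1ℤ)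
open import Data.Product using (_×_; _,_; Σ; ∃-syntax)
open import Data.Sum using (_⊎_)
open import Data.List using (List; length)
open import Data.List.Membership.Propositional using (_∈_)
open import Relation.Binary.PropositionalEquality using (_≡_)

-- Lattice points are (i , j) ∈ ℤ², the plane being
-- spanned by two unit vectors at 60°.  Each unit rhombus with lower-left
-- corner (i , j) splits into two unit triangles:
--   up   i j : vertices (i,j) , (i+1,j) , (i,j+1)
--   down i j : vertices (i+1,j) , (i,j+1) , (i+1,j+1)
data Cell : Set where
  up   : ℤ → ℤ → Cell
  down : ℤ → ℤ → Cell

data Adjacent : Cell → Cell → Set where
  ud₀ : ∀ i j → Adjacent (up i j) (down i j)
  ud₁ : ∀ i j → Adjacent (up i j) (down (i - 1ℤ) j)
  ud₂ : ∀ i j → Adjacent (up i j) (down i (j - 1ℤ))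
  du₀ : ∀ i j → Adjacent (down i j) (up i j)
  du₁ : ∀ i j → Adjacent (down i j) (up (i ℤ.+ 1ℤ) j)
  du₂ : ∀ i j → Adjacent (down i j) (up i (j ℤ.+ 1ℤ))

-- The maximal fragment centred at cell c: c together with its three neighbours.
InFragment : Cell → Cell → Set
InFragment c d = c ≡ d ⊎ Adjacent c d

-- The triangular board T_n with vertices (0,0), (n,0), (0,n):
-- up cells with i , j ≥ 0 , i + j + 1 ≤ n  and
-- down cells with i , j ≥ 0 , i + j + 2 ≤ n  (n² cells in total).
data InBoard (n : ℕ) : Cell → Set where
  board-up   : ∀ i j → i + j + 1 ≤ n → InBoard n (up (+ i) (+ j))
  board-down : ∀ i j → i + j + 2 ≤ n → InBoard n (down (+ i) (+ j))

-- A cover of T_n by maximal fragments: a finite collection of fragments,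
-- given by the list of their centres, whose union contains T_n.
Covers : ℕ → List Cell → Set
Covers n cs = ∀ d → InBoard n d → ∃[ c ] (c ∈ cs × InFragment c d)

ceil/4 : ℕ → ℕ
ceil/4 m = (m + 3) / 4

-- Every fragment has four cells and T_n has n² of them, so a cover uses at least ⌈n²/4⌉ fragments.
-- Conversely T_2k is tiled by k² triangles of side 2, strip of height 2 by strip of height 2: upright
-- ones are fragments centred at a down cell, inverted ones fragments centred at an up cell.  For odd n,
-- T_n is covered by tiled upright triangles of even sides 2kA, 2kB, 2kC placed at (0,0), (p,0), (0,q)
-- together with a tiled inverted triangle of side 2kD with corner (p,q) filling the gap between them.
-- For n = 4a+1 take (kA,kB,kC,kD) = (a,a+1,a,a), (p,q) = (2a−1,2a+1); for n = 4a+3 take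
-- (a,a+1,a+1,a+1), (p,q) = (2a+1,2a+1).  These use a² + (a+1)² + 2a² resp. a² + 3(a+1)² = ⌈n²/4⌉ fragments.
module Submission where

open import Defs
open import Data.Nat
  using (ℕ; zero; suc; pred; _+_; _*_; _≤_; _<_; z≤n; s≤s; s≤s⁻¹; _≤?_; _/_; compare; less; equal; greater)
open import Data.Nat.Properties
  using (≤-refl; ≤-reflexive; ≤-trans; ≰⇒>; +-suc; +-comm; +-identityʳ; +-assoc; +-cancelˡ-≤; +-monoˡ-≤; module ≤-Reasoning)
open import Data.Nat.DivMod using (m*n/n≡m; +-distrib-/-∣ˡ; /-monoˡ-≤)
open import Data.Nat.Divisibility using (divides)
open import Data.Nat.Tactic.RingSolver using (solve-∀; solve)
open import Data.Integer as ℤ using (ℤ; +_; _-_; 1ℤ)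
import Data.Integer.Tactic.RingSolver as ℤ-Solver
open import Data.Product using (_×_; _,_; ∃-syntax; map₁)
open import Data.Sum using (inj₁; inj₂)
open import Data.List using (List; []; _∷_; _++_; length; map; upTo; concatMap)
open import Data.List.Properties using (length-++; length-++-sucʳ; length-map; length-upTo)
open import Data.List.Membership.Propositional using (_∈_)
open import Data.List.Membership.Propositional.Properties
  using (∈-++⁺ˡ; ∈-++⁺ʳ; ∈-++⁻; ∈-map⁺; ∈-map⁻; ∈-upTo⁻; ∈-concat⁺′; ∈-∃++)
open import Data.List.Relation.Binary.Subset.Propositional using (_⊆_)
import Data.List.Relation.Unary.All as All
open import Data.List.Relation.Unary.Any using (here; there)
open import Data.List.Relation.Unary.Unique.Propositional using (Unique; []; _∷_)
open import Data.List.Relation.Unary.Unique.Propositional.Properties using (map⁺; ++⁺; upTo⁺)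
open import Relation.Nullary using (¬_; yes; no; contradiction)
open import Relation.Binary.PropositionalEquality
  using (_≡_; _≢_; refl; sym; trans; cong; cong₂; subst; module ≡-Reasoning)

-- Counting cells

∈-removed : ∀ {A : Set} {x y : A} us {vs} → x ≢ y → y ∈ us ++ x ∷ vs → y ∈ us ++ vs
∈-removed us x≢y y∈ with ∈-++⁻ us y∈
... | inj₁ y∈us         = ∈-++⁺ˡ y∈us
... | inj₂ (here y≡x)   = contradiction (sym y≡x) x≢y
... | inj₂ (there y∈vs) = ∈-++⁺ʳ us y∈vs

Unique⇒length≤ : ∀ {A : Set} {xs ys : List A} → Unique xs → xs ⊆ ys → length xs ≤ length ys
Unique⇒length≤ [] _ = z≤n
Unique⇒length≤ {xs = x ∷ xs} (x∉xs ∷ uniq) xs⊆ys with ∈-∃++ (xs⊆ys (here refl))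
... | us , vs , refl = ≤-trans
  (s≤s (Unique⇒length≤ uniq (λ y∈xs → ∈-removed us (All.lookup x∉xs y∈xs) (xs⊆ys (there y∈xs)))))
  (≤-reflexive (sym (length-++-sucʳ us x vs)))

fragment : Cell → List Cell
fragment (up i j)   = up i j ∷ down i j ∷ down (i - 1ℤ) j ∷ down i (j - 1ℤ) ∷ []
fragment (down i j) = down i j ∷ up i j ∷ up (i ℤ.+ 1ℤ) j ∷ up i (j ℤ.+ 1ℤ) ∷ []

∈-fragment : ∀ {c d} → InFragment c d → d ∈ fragment c
∈-fragment {up _ _}   (inj₁ refl)      = here refl
∈-fragment {down _ _} (inj₁ refl)      = here refl
∈-fragment            (inj₂ (ud₀ _ _)) = there (here refl)
∈-fragment            (inj₂ (ud₁ _ _)) = there (there (here refl))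
∈-fragment            (inj₂ (ud₂ _ _)) = there (there (there (here refl)))
∈-fragment            (inj₂ (du₀ _ _)) = there (here refl)
∈-fragment            (inj₂ (du₁ _ _)) = there (there (here refl))
∈-fragment            (inj₂ (du₂ _ _)) = there (there (there (here refl)))

length-concatMap-fragment : ∀ cs → length (concatMap fragment cs) ≡ length cs * 4
length-concatMap-fragment []             = refl
length-concatMap-fragment (up i j ∷ cs)   = cong (λ l → 4 + l) (length-concatMap-fragment cs)
length-concatMap-fragment (down i j ∷ cs) = cong (λ l → 4 + l) (length-concatMap-fragment cs)

leftEdge : ℕ → ℕ × ℕ
leftEdge j = 0 , j

shiftRight : ℕ × ℕ → ℕ × ℕ
shiftRight = map₁ suc

triangle : ℕ → List (ℕ × ℕ)
triangle zero    = []
triangle (suc n) = map leftEdge (upTo (suc n)) ++ map shiftRight (triangle n)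

∈-triangle⁻ : ∀ {n i j} → (i , j) ∈ triangle n → i + j < n
∈-triangle⁻ {zero} ()
∈-triangle⁻ {suc n} v∈ with ∈-++⁻ (map leftEdge (upTo (suc n))) v∈
... | inj₁ v∈edge with ∈-map⁻ leftEdge v∈edge
...   | _ , j∈ , refl = ∈-upTo⁻ j∈
∈-triangle⁻ {suc n} v∈ | inj₂ v∈rest with ∈-map⁻ shiftRight v∈rest
...   | _ , w∈ , refl = s≤s (∈-triangle⁻ w∈)

Unique-triangle : ∀ n → Unique (triangle n)
Unique-triangle zero    = []
Unique-triangle (suc n) =
  ++⁺ (map⁺ (λ { refl → refl }) (upTo⁺ (suc n))) (map⁺ (λ { refl → refl }) (Unique-triangle n)) disjoint
  where
  disjoint : ∀ {v} → ¬ (v ∈ map leftEdge (upTo (suc n)) × v ∈ map shiftRight (triangle n))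
  disjoint (v∈ , v∈′) with ∈-map⁻ leftEdge v∈ | ∈-map⁻ shiftRight v∈′
  ... | _ , _ , refl | _ , _ , ()

length-triangle-suc : ∀ n → length (triangle (suc n)) ≡ suc n + length (triangle n)
length-triangle-suc n = trans (length-++ (map leftEdge (upTo (suc n))))
  (cong₂ _+_ (trans (length-map leftEdge (upTo (suc n))) (length-upTo (suc n))) (length-map shiftRight (triangle n)))

length-triangle-twice : ∀ n → length (triangle n) + length (triangle n) ≡ n + n * n
length-triangle-twice zero    = refl
length-triangle-twice (suc n) = begin
  length (triangle (suc n)) + length (triangle (suc n)) ≡⟨ cong₂ _+_ (length-triangle-suc n) (length-triangle-suc n) ⟩
  (suc n + t) + (suc n + t)                             ≡⟨ interchange (suc n) t ⟩
  (suc n + suc n) + (t + t)                             ≡⟨ cong (λ l → (suc n + suc n) + l) (length-triangle-twice n) ⟩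
  (suc n + suc n) + (n + n * n)                         ≡⟨ solve (n ∷ []) ⟩
  suc n + suc n * suc n                                 ∎
  where
  open ≡-Reasoning
  t : ℕ
  t = length (triangle n)
  interchange : ∀ m t → (m + t) + (m + t) ≡ (m + m) + (t + t)
  interchange = solve-∀

upAt downAt : ℕ × ℕ → Cell
upAt   (i , j) = up (+ i) (+ j)
downAt (i , j) = down (+ i) (+ j)

upAt-injective : ∀ {v w} → upAt v ≡ upAt w → v ≡ w
upAt-injective {_ , _} {_ , _} refl = refl

downAt-injective : ∀ {v w} → downAt v ≡ downAt w → v ≡ w
downAt-injective {_ , _} {_ , _} refl = refl

boardCells : ℕ → List Cell
boardCells n = map upAt (triangle n) ++ map downAt (triangle (pred n))

∈-boardCells⁻ : ∀ {n d} → d ∈ boardCells n → InBoard n d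
∈-boardCells⁻ {zero} ()
∈-boardCells⁻ {suc n} d∈ with ∈-++⁻ (map upAt (triangle (suc n))) d∈
... | inj₁ d∈ups with ∈-map⁻ upAt d∈ups
...   | (i , j) , v∈ , refl = board-up i j (≤-trans (≤-reflexive (+-comm (i + j) 1)) (∈-triangle⁻ v∈))
∈-boardCells⁻ {suc n} d∈ | inj₂ d∈downs with ∈-map⁻ downAt d∈downs
...   | (i , j) , v∈ , refl = board-down i j (≤-trans (≤-reflexive (+-comm (i + j) 2)) (s≤s (∈-triangle⁻ v∈)))

Unique-boardCells : ∀ n → Unique (boardCells n)
Unique-boardCells n =
  ++⁺ (map⁺ upAt-injective (Unique-triangle n)) (map⁺ downAt-injective (Unique-triangle (pred n))) disjoint
  where
  disjoint : ∀ {d} → ¬ (d ∈ map upAt (triangle n) × d ∈ map downAt (triangle (pred n)))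
  disjoint (d∈ , d∈′) with ∈-map⁻ upAt d∈ | ∈-map⁻ downAt d∈′
  ... | _ , _ , refl | _ , _ , ()

length-boardCells : ∀ n → length (boardCells n) ≡ n * n
length-boardCells zero    = refl
length-boardCells (suc n) = begin
  length (map upAt (triangle (suc n)) ++ map downAt (triangle n))
    ≡⟨ length-++ (map upAt (triangle (suc n))) ⟩
  length (map upAt (triangle (suc n))) + length (map downAt (triangle n))
    ≡⟨ cong₂ _+_ (trans (length-map upAt (triangle (suc n))) (length-triangle-suc n)) (length-map downAt (triangle n)) ⟩
  (suc n + t) + t ≡⟨ +-assoc (suc n) t t ⟩
  suc n + (t + t) ≡⟨ cong (λ l → suc n + l) (length-triangle-twice n) ⟩
  suc n + (n + n * n) ≡⟨ solve (n ∷ []) ⟩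
  suc n * suc n ∎
  where
  open ≡-Reasoning
  t : ℕ
  t = length (triangle n)

boardCells⊆fragments : ∀ {n cs} → Covers n cs → boardCells n ⊆ concatMap fragment cs
boardCells⊆fragments cov d∈ with cov _ (∈-boardCells⁻ d∈)
... | _ , c∈cs , frag = ∈-concat⁺′ (∈-fragment frag) (∈-map⁺ fragment c∈cs)

n*n≤length*4 : ∀ {n cs} → Covers n cs → n * n ≤ length cs * 4
n*n≤length*4 {n} {cs} cov = begin
  n * n                              ≡⟨ length-boardCells n ⟨
  length (boardCells n)              ≤⟨ Unique⇒length≤ (Unique-boardCells n) (boardCells⊆fragments cov) ⟩
  length (concatMap fragment cs)     ≡⟨ length-concatMap-fragment cs ⟩
  length cs * 4                      ∎
  where open ≤-Reasoning

ceil/4-*4 : ∀ k → ceil/4 (k * 4) ≡ k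
ceil/4-*4 k = trans (+-distrib-/-∣ˡ 3 (divides k refl)) (trans (+-identityʳ (k * 4 / 4)) (m*n/n≡m k 4))

ceil/4-exact : ∀ {m k} → m + 3 ≡ k * 4 → ceil/4 m ≡ k
ceil/4-exact {k = k} m+3≡k*4 = trans (cong (_/ 4) m+3≡k*4) (m*n/n≡m k 4)

ceil/4-n*n≤length : ∀ {n cs} → Covers n cs → ceil/4 (n * n) ≤ length cs
ceil/4-n*n≤length {n} {cs} cov = begin
  ceil/4 (n * n)          ≤⟨ /-monoˡ-≤ 4 (+-monoˡ-≤ 3 (n*n≤length*4 cov)) ⟩
  ceil/4 (length cs * 4)  ≡⟨ ceil/4-*4 (length cs) ⟩
  length cs               ∎
  where open ≤-Reasoning

-- Tiling a triangle of even side

double : ℕ → ℕ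
double zero    = zero
double (suc n) = suc (suc (double n))

double≡+ : ∀ n → double n ≡ n + n
double≡+ zero    = refl
double≡+ (suc n) = cong suc (trans (cong suc (double≡+ n)) (sym (+-suc n n)))

x-1+1≡x : ∀ x → x - 1ℤ ℤ.+ 1ℤ ≡ x
x-1+1≡x = ℤ-Solver.solve-∀

x+1-1≡x : ∀ x → x ℤ.+ 1ℤ - 1ℤ ≡ x
x+1-1≡x = ℤ-Solver.solve-∀

Adjacent-sym : ∀ {c d} → Adjacent c d → Adjacent d c
Adjacent-sym (ud₀ i j) = du₀ i j
Adjacent-sym (ud₁ i j) = subst (λ x → Adjacent (down (i - 1ℤ) j) (up x j)) (x-1+1≡x i) (du₁ (i - 1ℤ) j)
Adjacent-sym (ud₂ i j) = subst (λ y → Adjacent (down i (j - 1ℤ)) (up i y)) (x-1+1≡x j) (du₂ i (j - 1ℤ))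
Adjacent-sym (du₀ i j) = ud₀ i j
Adjacent-sym (du₁ i j) = subst (λ x → Adjacent (up (i ℤ.+ 1ℤ) j) (down x j)) (x+1-1≡x i) (ud₁ (i ℤ.+ 1ℤ) j)
Adjacent-sym (du₂ i j) = subst (λ y → Adjacent (up i (j ℤ.+ 1ℤ)) (down i y)) (x+1-1≡x j) (ud₂ i (j ℤ.+ 1ℤ))

Covered : List Cell → Cell → Set
Covered cs d = ∃[ c ] (c ∈ cs × InFragment c d)

covered-by-centre : ∀ {cs d} → d ∈ cs → Covered cs d
covered-by-centre d∈cs = _ , d∈cs , inj₁ refl

covered-by-neighbour : ∀ {cs c d} → c ∈ cs → Adjacent c d → Covered cs d
covered-by-neighbour c∈cs adj = _ , c∈cs , inj₂ adj

Covered-mono : ∀ {cs ds d} → cs ⊆ ds → Covered cs d → Covered ds d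
Covered-mono cs⊆ds (c , c∈cs , frag) = c , cs⊆ds c∈cs , frag

-- The grid seen through an adjacency-preserving change of coordinates to ℕ²: translations have
-- ▵ = up and ▿ = down, the point reflection swaps the two roles.
record Frame : Set where
  field
    ▵ ▿  : ℕ → ℕ → Cell
    adj₀ : ∀ a b → Adjacent (▿ a b) (▵ a b)
    adjˣ : ∀ a b → Adjacent (▿ a b) (▵ (suc a) b)
    adjʸ : ∀ a b → Adjacent (▿ a b) (▵ a (suc b))

open Frame

shiftˣ shiftʸ : Frame → Frame
shiftˣ F = record
  { ▵ = λ a b → ▵ F (suc (suc a)) b ; ▿ = λ a b → ▿ F (suc (suc a)) b
  ; adj₀ = λ a b → adj₀ F _ b ; adjˣ = λ a b → adjˣ F _ b ; adjʸ = λ a b → adjʸ F _ b }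
shiftʸ F = record
  { ▵ = λ a b → ▵ F a (suc (suc b)) ; ▿ = λ a b → ▿ F a (suc (suc b))
  ; adj₀ = λ a b → adj₀ F a _ ; adjˣ = λ a b → adjˣ F a _ ; adjʸ = λ a b → adjʸ F a _ }

-- The two bottom rows of the triangle of side 2K + 2, tiled alternately by an upright side-2 triangle
-- (centred at a ▿ cell) and an inverted one (centred at a ▵ cell).
strip : Frame → ℕ → List Cell
strip F zero    = ▿ F 0 0 ∷ []
strip F (suc K) = ▿ F 0 0 ∷ ▵ F 1 1 ∷ strip (shiftˣ F) K

▿₀₀∈strip : ∀ F K → ▿ F 0 0 ∈ strip F K
▿₀₀∈strip F zero    = here refl
▿₀₀∈strip F (suc K) = here refl

covered-∷∷ : ∀ {c c′ cs d} → Covered cs d → Covered (c ∷ c′ ∷ cs) d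
covered-∷∷ = Covered-mono (λ x∈cs → there (there x∈cs))

strip-covers-▵₀ : ∀ F K {a} → a ≤ suc (double K) → Covered (strip F K) (▵ F a 0)
strip-covers-▵₀ F K       {0}           _               = covered-by-neighbour (▿₀₀∈strip F K) (adj₀ F 0 0)
strip-covers-▵₀ F K       {1}           _               = covered-by-neighbour (▿₀₀∈strip F K) (adjˣ F 0 0)
strip-covers-▵₀ F (suc K) {suc (suc a)} (s≤s (s≤s a≤)) = covered-∷∷ (strip-covers-▵₀ (shiftˣ F) K a≤)

strip-covers-▵₁ : ∀ F K {a} → a ≤ double K → Covered (strip F K) (▵ F a 1)
strip-covers-▵₁ F K       {0}           _               = covered-by-neighbour (▿₀₀∈strip F K) (adjʸ F 0 0)
strip-covers-▵₁ F (suc K) {1}           _               = covered-by-centre (there (here refl))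
strip-covers-▵₁ F (suc K) {suc (suc a)} (s≤s (s≤s a≤)) = covered-∷∷ (strip-covers-▵₁ (shiftˣ F) K a≤)

strip-covers-▿₀ : ∀ F K {a} → a ≤ double K → Covered (strip F K) (▿ F a 0)
strip-covers-▿₀ F K       {0}           _               = covered-by-centre (▿₀₀∈strip F K)
strip-covers-▿₀ F (suc K) {1}           _               = covered-by-neighbour (there (here refl)) (Adjacent-sym (adjʸ F 1 0))
strip-covers-▿₀ F (suc K) {suc (suc a)} (s≤s (s≤s a≤)) = covered-∷∷ (strip-covers-▿₀ (shiftˣ F) K a≤)

strip-covers-▿₁ : ∀ F K {a} → suc a ≤ double K → Covered (strip F K) (▿ F a 1)
strip-covers-▿₁ F (suc K) {0}           _               = covered-by-neighbour (there (here refl)) (Adjacent-sym (adjˣ F 0 1))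
strip-covers-▿₁ F (suc K) {1}           _               = covered-by-neighbour (there (here refl)) (Adjacent-sym (adj₀ F 1 1))
strip-covers-▿₁ F (suc K) {suc (suc a)} (s≤s (s≤s a≤)) = covered-∷∷ (strip-covers-▿₁ (shiftˣ F) K a≤)

length-strip : ∀ F K → length (strip F K) ≡ suc (double K)
length-strip F zero    = refl
length-strip F (suc K) = cong (λ l → suc (suc l)) (length-strip (shiftˣ F) K)

tiling : Frame → ℕ → List Cell
tiling F zero    = []
tiling F (suc K) = strip F K ++ tiling (shiftʸ F) K

tiling-covers-▵ : ∀ F K {a b} → suc (b + a) ≤ double K → Covered (tiling F K) (▵ F a b)
tiling-covers-▵ F (suc K) {b = 0}           (s≤s a≤)       = Covered-mono ∈-++⁺ˡ (strip-covers-▵₀ F K a≤)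
tiling-covers-▵ F (suc K) {b = 1}           (s≤s (s≤s a≤)) = Covered-mono ∈-++⁺ˡ (strip-covers-▵₁ F K a≤)
tiling-covers-▵ F (suc K) {b = suc (suc b)} (s≤s (s≤s ≤K)) = Covered-mono (∈-++⁺ʳ (strip F K)) (tiling-covers-▵ (shiftʸ F) K ≤K)

tiling-covers-▿ : ∀ F K {a b} → suc (suc (b + a)) ≤ double K → Covered (tiling F K) (▿ F a b)
tiling-covers-▿ F (suc K) {b = 0}           (s≤s (s≤s a≤)) = Covered-mono ∈-++⁺ˡ (strip-covers-▿₀ F K a≤)
tiling-covers-▿ F (suc K) {b = 1}           (s≤s (s≤s a≤)) = Covered-mono ∈-++⁺ˡ (strip-covers-▿₁ F K a≤)
tiling-covers-▿ F (suc K) {b = suc (suc b)} (s≤s (s≤s ≤K)) = Covered-mono (∈-++⁺ʳ (strip F K)) (tiling-covers-▿ (shiftʸ F) K ≤K)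

length-tiling : ∀ F K → length (tiling F K) ≡ K * K
length-tiling F zero    = refl
length-tiling F (suc K) = begin
  length (strip F K ++ tiling (shiftʸ F) K)          ≡⟨ length-++ (strip F K) ⟩
  length (strip F K) + length (tiling (shiftʸ F) K)  ≡⟨ cong₂ _+_ (length-strip F K) (length-tiling (shiftʸ F) K) ⟩
  suc (double K) + K * K                             ≡⟨ cong (λ d → suc d + K * K) (double≡+ K) ⟩
  suc (K + K) + K * K                                ≡⟨ solve (K ∷ []) ⟩
  suc K * suc K                                      ∎
  where open ≡-Reasoning

-- Covering T_n

+[m+n]+1≡+[m+1+n] : ∀ m n → + (m + n) ℤ.+ 1ℤ ≡ + (m + suc n)
+[m+n]+1≡+[m+1+n] m n = cong +_ (trans (+-comm (m + n) 1) (sym (+-suc m n)))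

x-[1+n]-1≡x-[2+n] : ∀ x n → x - + suc n - 1ℤ ≡ x - + suc (suc n)
x-[1+n]-1≡x-[2+n] x n = trans (x-y-1≡x-[y+1] x (+ suc n)) (cong (λ m → x - + m) (+-comm (suc n) 1))
  where
  x-y-1≡x-[y+1] : ∀ x y → x - y - 1ℤ ≡ x - (y ℤ.+ 1ℤ)
  x-y-1≡x-[y+1] = ℤ-Solver.solve-∀

+[1+i+a]-[1+a]≡+i : ∀ {i a p} → suc (i + a) ≡ p → + p - + suc a ≡ + i
+[1+i+a]-[1+a]≡+i {i} {a} refl = trans (cong (λ m → + m - + suc a) (sym (+-suc i a))) (x+y-y≡x (+ i) (+ suc a))
  where
  x+y-y≡x : ∀ x y → x ℤ.+ y - y ≡ x
  x+y-y≡x = ℤ-Solver.solve-∀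

upright : ℕ → ℕ → Frame
upright p q = record
  { ▵    = λ a b → up (x a) (y b)
  ; ▿    = λ a b → down (x a) (y b)
  ; adj₀ = λ a b → du₀ (x a) (y b)
  ; adjˣ = λ a b → subst (λ x′ → Adjacent (down (x a) (y b)) (up x′ (y b))) (+[m+n]+1≡+[m+1+n] p a) (du₁ (x a) (y b))
  ; adjʸ = λ a b → subst (λ y′ → Adjacent (down (x a) (y b)) (up (x a) y′)) (+[m+n]+1≡+[m+1+n] q b) (du₂ (x a) (y b))
  }
  where
  x y : ℕ → ℤ
  x a = + (p + a)
  y b = + (q + b)

-- The image of the grid under the point reflection v ↦ (p , q) − v of lattice points.
inverted : ℕ → ℕ → Frame
inverted p q = record
  { ▵    = λ a b → down (x a) (y b)
  ; ▿    = λ a b → up (x a) (y b)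
  ; adj₀ = λ a b → ud₀ (x a) (y b)
  ; adjˣ = λ a b → subst (λ x′ → Adjacent (up (x a) (y b)) (down x′ (y b))) (x-[1+n]-1≡x-[2+n] (+ p) a) (ud₁ (x a) (y b))
  ; adjʸ = λ a b → subst (λ y′ → Adjacent (up (x a) (y b)) (down (x a) y′)) (x-[1+n]-1≡x-[2+n] (+ q) b) (ud₂ (x a) (y b))
  }
  where
  x y : ℕ → ℤ
  x a = + p - + suc a
  y b = + q - + suc b

t+[j+i]≡i+j+t : ∀ t i j → t + (j + i) ≡ i + j + t
t+[j+i]≡i+j+t = solve-∀

tiling-covers-board : ∀ {n K} → n ≤ double K → Covers n (tiling (upright 0 0) K)
tiling-covers-board {K = K} n≤ _ (board-up i j h) =
  tiling-covers-▵ (upright 0 0) K (≤-trans (≤-reflexive (t+[j+i]≡i+j+t 1 i j)) (≤-trans h n≤))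
tiling-covers-board {K = K} n≤ _ (board-down i j h) =
  tiling-covers-▿ (upright 0 0) K (≤-trans (≤-reflexive (t+[j+i]≡i+j+t 2 i j)) (≤-trans h n≤))

data Split (p : ℕ) : ℕ → Set where
  beyond : ∀ a → Split p (p + a)
  before : ∀ {i} a → suc (i + a) ≡ p → Split p i

split : ∀ p i → Split p i
split p i with compare i p
... | less .i a    = before a refl
... | equal .p     = subst (Split p) (+-identityʳ p) (beyond 0)
... | greater .p a = subst (Split p) (+-suc p a) (beyond (suc a))

offsetˣ : ∀ {p a j t n m} → p + a + j + t ≤ n → n ≤ p + m → t + (j + a) ≤ m
offsetˣ {p} {a} {j} {t} h n≤ = +-cancelˡ-≤ p _ _ (≤-trans (≤-reflexive (reorder p a j t)) (≤-trans h n≤))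
  where
  reorder : ∀ p a j t → p + (t + (j + a)) ≡ p + a + j + t
  reorder = solve-∀

offsetʸ : ∀ {q b i t n m} → i + (q + b) + t ≤ n → n ≤ q + m → t + (b + i) ≤ m
offsetʸ {q} {b} {i} {t} h n≤ = +-cancelˡ-≤ q _ _ (≤-trans (≤-reflexive (reorder q b i t)) (≤-trans h n≤))
  where
  reorder : ∀ q b i t → q + (t + (b + i)) ≡ i + (q + b) + t
  reorder = solve-∀

x+y≤m+w⇒y≤w : ∀ {x y m w} → m ≤ x → x + y ≤ m + w → y ≤ w
x+y≤m+w⇒y≤w {x} {y} {m} {w} m≤x x+y≤ = +-cancelˡ-≤ x y w (≤-trans x+y≤ (+-monoˡ-≤ w m≤x))

fourTriangles : (p q kA kB kC kD : ℕ) → List Cell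
fourTriangles p q kA kB kC kD =
  tiling (upright 0 0) kA ++ tiling (upright p 0) kB ++ tiling (upright 0 q) kC ++ tiling (inverted p q) kD

module _ {n : ℕ} (p q kA kB kC kD : ℕ)
         (n≤p+B : n ≤ p + double kB) (n≤q+C : n ≤ q + double kC) (p+q≤A+D : p + q ≤ double kA + double kD)
         where

  private
    A B C D : List Cell
    A = tiling (upright 0 0) kA
    B = tiling (upright p 0) kB
    C = tiling (upright 0 q) kC
    D = tiling (inverted p q) kD

    inA : ∀ {d} → Covered A d → Covered (A ++ B ++ C ++ D) d
    inA = Covered-mono ∈-++⁺ˡ
    inB : ∀ {d} → Covered B d → Covered (A ++ B ++ C ++ D) d
    inB = Covered-mono (λ m → ∈-++⁺ʳ A (∈-++⁺ˡ m))
    inC : ∀ {d} → Covered C d → Covered (A ++ B ++ C ++ D) d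
    inC = Covered-mono (λ m → ∈-++⁺ʳ A (∈-++⁺ʳ B (∈-++⁺ˡ m)))
    inD : ∀ {d} → Covered D d → Covered (A ++ B ++ C ++ D) d
    inD = Covered-mono (λ m → ∈-++⁺ʳ A (∈-++⁺ʳ B (∈-++⁺ʳ C m)))

    regroup : ∀ s u i j a b → (s + (j + i)) + (u + (b + a)) ≡ (s + u) + ((i + a) + (j + b))
    regroup = solve-∀

    -- A cell (i , j) with i < p, j < q outside the triangle of side 2kA has coordinates
    -- (a , b) in the reflected frame, and a + b is small because p + q ≤ 2kA + 2kD.
    inMiddle : ∀ s u i j a b → s + u ≡ 2 → suc (i + a) ≡ p → suc (j + b) ≡ q →
               double kA ≤ s + (j + i) → u + (b + a) ≤ double kD
    inMiddle s u i j a b s+u≡2 refl refl ≥A = x+y≤m+w⇒y≤w ≥A (begin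
      (s + (j + i)) + (u + (b + a))  ≡⟨ regroup s u i j a b ⟩
      (s + u) + ((i + a) + (j + b))  ≡⟨ cong (λ t → t + ((i + a) + (j + b))) s+u≡2 ⟩
      2 + ((i + a) + (j + b))        ≡⟨ cong suc (sym (+-suc (i + a) (j + b))) ⟩
      suc (i + a) + suc (j + b)      ≤⟨ p+q≤A+D ⟩
      double kA + double kD          ∎)
      where open ≤-Reasoning

    ▿-inMiddle : ∀ {i j a b} → suc (i + a) ≡ p → suc (j + b) ≡ q → double kA ≤ j + i →
                 Covered (A ++ B ++ C ++ D) (up (+ i) (+ j))
    ▿-inMiddle {i} {j} {a} {b} 1+i+a≡p 1+j+b≡q ≥A = inD (subst (Covered D)
      (cong₂ up (+[1+i+a]-[1+a]≡+i 1+i+a≡p) (+[1+i+a]-[1+a]≡+i 1+j+b≡q))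
      (tiling-covers-▿ (inverted p q) kD (inMiddle 0 2 i j a b refl 1+i+a≡p 1+j+b≡q ≥A)))

    ▵-inMiddle : ∀ {i j a b} → suc (i + a) ≡ p → suc (j + b) ≡ q → double kA ≤ suc (j + i) →
                 Covered (A ++ B ++ C ++ D) (down (+ i) (+ j))
    ▵-inMiddle {i} {j} {a} {b} 1+i+a≡p 1+j+b≡q ≥A = inD (subst (Covered D)
      (cong₂ down (+[1+i+a]-[1+a]≡+i 1+i+a≡p) (+[1+i+a]-[1+a]≡+i 1+j+b≡q))
      (tiling-covers-▵ (inverted p q) kD (inMiddle 1 1 i j a b refl 1+i+a≡p 1+j+b≡q ≥A)))

  fourTriangles-covers : Covers n (fourTriangles p q kA kB kC kD)
  fourTriangles-covers _ (board-up i j h) with split p i | split q j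
  ... | beyond a   | _        = inB (tiling-covers-▵ (upright p 0) kB (offsetˣ {a = a} {j} {1} h n≤p+B))
  ... | before a _ | beyond b = inC (tiling-covers-▵ (upright 0 q) kC (offsetʸ {b = b} {i} {1} h n≤q+C))
  ... | before a 1+i+a≡p | before b 1+j+b≡q with suc (j + i) ≤? double kA
  ...   | yes ≤A = inA (tiling-covers-▵ (upright 0 0) kA ≤A)
  ...   | no ≰A  = ▿-inMiddle 1+i+a≡p 1+j+b≡q (s≤s⁻¹ (≰⇒> ≰A))
  fourTriangles-covers _ (board-down i j h) with split p i | split q j
  ... | beyond a   | _        = inB (tiling-covers-▿ (upright p 0) kB (offsetˣ {a = a} {j} {2} h n≤p+B))
  ... | before a _ | beyond b = inC (tiling-covers-▿ (upright 0 q) kC (offsetʸ {b = b} {i} {2} h n≤q+C))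
  ... | before a 1+i+a≡p | before b 1+j+b≡q with suc (suc (j + i)) ≤? double kA
  ...   | yes ≤A = inA (tiling-covers-▿ (upright 0 0) kA ≤A)
  ...   | no ≰A  = ▵-inMiddle 1+i+a≡p 1+j+b≡q (s≤s⁻¹ (≰⇒> ≰A))

length-fourTriangles : ∀ p q kA kB kC kD →
  length (fourTriangles p q kA kB kC kD) ≡ kA * kA + (kB * kB + (kC * kC + kD * kD))
length-fourTriangles p q kA kB kC kD = begin
  length (A ++ B ++ C ++ D)                            ≡⟨ length-++ A ⟩
  length A + length (B ++ C ++ D)                      ≡⟨ cong (λ l → length A + l) (length-++ B) ⟩
  length A + (length B + length (C ++ D))              ≡⟨ cong (λ l → length A + (length B + l)) (length-++ C) ⟩
  length A + (length B + (length C + length D))        ≡⟨ cong₂ _+_ (length-tiling _ kA) (cong₂ _+_ (length-tiling _ kB)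
                                                            (cong₂ _+_ (length-tiling _ kC) (length-tiling _ kD))) ⟩
  kA * kA + (kB * kB + (kC * kC + kD * kD))            ∎
  where
  open ≡-Reasoning
  A B C D : List Cell
  A = tiling (upright 0 0) kA
  B = tiling (upright p 0) kB
  C = tiling (upright 0 q) kC
  D = tiling (inverted p q) kD

data Parity : ℕ → Set where
  even : ∀ k → Parity (double k)
  odd  : ∀ k → Parity (suc (double k))

parity : ∀ n → Parity n
parity zero = even 0
parity (suc n) with parity n
... | even k = odd k
... | odd k  = even (suc k)

OptimalCover : ℕ → Set
OptimalCover n = ∃[ cs ] (Covers n cs × length cs ≡ ceil/4 (n * n))

optimalCover-2k : ∀ k → OptimalCover (double k)
optimalCover-2k k = tiling (upright 0 0) k , tiling-covers-board ≤-refl , trans (length-tiling _ k) (sym area)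
  where
  area : ceil/4 (double k * double k) ≡ k * k
  area rewrite double≡+ k = trans (cong ceil/4 (square k)) (ceil/4-*4 (k * k))
    where
    square : ∀ k → (k + k) * (k + k) ≡ k * k * 4
    square = solve-∀

optimalCover-4b+5 : ∀ b → OptimalCover (suc (double (double (suc b))))
optimalCover-4b+5 b =
  fourTriangles p q a (suc a) a a ,
  fourTriangles-covers p q a (suc a) a a (≤-reflexive sideˣ) (≤-reflexive sideʸ) (≤-reflexive middle) ,
  trans (length-fourTriangles p q a (suc a) a a) (sym (ceil/4-exact {n * n} area))
  where
  n a p q : ℕ
  n = suc (double (double a))
  a = suc b
  p = suc (double b)
  q = suc (double a)
  sideˣ : n ≡ p + double (suc a)
  sideˣ rewrite double≡+ b | double≡+ (b + b) = solve (b ∷ [])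
  sideʸ : n ≡ q + double a
  sideʸ rewrite double≡+ b | double≡+ (b + b) = solve (b ∷ [])
  middle : p + q ≡ double a + double a
  middle rewrite double≡+ b = solve (b ∷ [])
  area : n * n + 3 ≡ (a * a + (suc a * suc a + (a * a + a * a))) * 4
  area rewrite double≡+ b | double≡+ (b + b) = solve (b ∷ [])

optimalCover-4a+3 : ∀ a → OptimalCover (suc (suc (suc (double (double a)))))
optimalCover-4a+3 a =
  fourTriangles p p a (suc a) (suc a) (suc a) ,
  fourTriangles-covers p p a (suc a) (suc a) (suc a) (≤-reflexive side) (≤-reflexive side) (≤-reflexive middle) ,
  trans (length-fourTriangles p p a (suc a) (suc a) (suc a)) (sym (ceil/4-exact {n * n} area))
  where
  n p : ℕ
  n = suc (suc (suc (double (double a))))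
  p = suc (double a)
  side : n ≡ p + double (suc a)
  side rewrite double≡+ a | double≡+ (a + a) = solve (a ∷ [])
  middle : p + p ≡ double a + double (suc a)
  middle rewrite double≡+ a = solve (a ∷ [])
  area : n * n + 3 ≡ (a * a + (suc a * suc a + (suc a * suc a + suc a * suc a))) * 4
  area rewrite double≡+ a | double≡+ (a + a) = solve (a ∷ [])

optimalCover : ∀ n → OptimalCover n
optimalCover n with parity n
... | even k = optimalCover-2k k
... | odd k with parity k
...   | even zero    = tiling (upright 0 0) 1 , tiling-covers-board {K = 1} (s≤s z≤n) , refl
...   | even (suc b) = optimalCover-4b+5 b
...   | odd a        = optimalCover-4a+3 a

-- T_0 is empty.
mainTheorem13 : ∀ (n : ℕ) → 1 ≤ n →
    (∃[ cs ] (Covers n cs × length cs ≡ ceil/4 (n * n)))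
    × (∀ (cs : List Cell) → Covers n cs → ceil/4 (n * n) ≤ length cs)
mainTheorem13 n _ = optimalCover n , λ cs → ceil/4-n*n≤length {n} {cs}
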